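{- Let $(p,R)$ and $(p',R')$ be mesh patterns. If $(p,R)\asymp(p',R')$, then $p=p'$.
   Context: A mesh pattern is a pair $(p,R)$ where $p\in\mathfrak{S}_k$ for some $k$ and $R\subseteq\{0,\dots,k\}^2$, where $(a,b)\in R$ denotes the unit square $[a,a+1]\times[b,b+1]$ in $[0,k+1]^2$. A permutation $w\in\mathfrak{S}_n$ contains $(p,R)$ if there are indices $1\le i_1<\dots<i_k\le n$ with $w(i_1)\cdots w(i_k)$ order isomorphic to $p$ such that, setting $i_0=0$, $i_{k+1}=n+1$, $v_0=0$, $v_{k+1}=n+1$ and $v_b=w(i_{p^{ -1}(b)})$ for $b\in[1,k]$, for every $(a,b)\in R$ the open rectangle $(i_a,i_{a+1})\times(v_b,v_{b+1})$ contains no point $(x,w(x))$, $x\in[1,n]$. Otherwise $w$ avoids $(p,R)$. $\mathrm{Av}(\pi)$ is the set of permutations (of all sizes) avoiding $\pi$. Two mesh patterns $\pi,\sigma$ are coincident, written $\pi\asymp\sigma$, if $\mathrm{Av}(\pi)=\mathrm{Av}(\sigma)$. -}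

module Defs where

open import Data.Nat using (ℕ; zero; suc; _+_; _∸_; _<_; _≤_)
open import Data.Bool using (Bool; true)
open import Data.Fin using (Fin; fromℕ<)
open import Data.List using (List; []; _∷_; length; map; upTo)
open import Data.List.Relation.Binary.Permutation.Propositional using (_↭_)
open import Data.Product using (Σ; _×_; ∃₂)
open import Relation.Nullary using (¬_)
open import Relation.Binary.PropositionalEquality using (_≡_)

-- A permutation in 𝔖_k, in one-line notation: a list of length k which is a
-- rearrangement of [1, 2, ..., k].
record Perm : Set where
  constructor mkPerm
  field
    word   : List ℕ
    isPerm : word ↭ map suc (upTo (length word))

open Perm public

size : Perm → ℕ
size p = length (word p)

-- 1-indexed evaluation:  at l i = l(i) for 1 ≤ i ≤ length l  (junk 0 otherwise)
at : List ℕ → ℕ → ℕ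
at []       _             = 0
at (x ∷ xs) zero          = 0
at (x ∷ xs) (suc zero)    = x
at (x ∷ xs) (suc (suc i)) = at xs (suc i)

ev : Perm → ℕ → ℕ
ev p = at (word p)

-- A mesh pattern (p, R): R ⊆ {0,…,k}², given by its (Boolean) characteristic
-- function on Fin (k+1) × Fin (k+1).
record MeshPattern : Set where
  constructor mesh
  field
    pat   : Perm
    shade : Fin (suc (size pat)) → Fin (suc (size pat)) → Bool

open MeshPattern public

-- (a , b) ∈ R, for natural numbers a, b (false outside {0,…,k}²)
InR : (π : MeshPattern) → ℕ → ℕ → Set
InR π a b =
  Σ (a < suc (size (pat π))) λ ha →
  Σ (b < suc (size (pat π))) λ hb →
  shade π (fromℕ< ha) (fromℕ< hb) ≡ true

-- The function I gives the
-- indices i_0 = 0 < i_1 < … < i_k < i_{k+1} = n+1, and V gives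
-- v_0 = 0, v_{k+1} = n+1, v_b = w(i_{p⁻¹(b)}) (stated as v_{p(a)} = w(i_a)
-- for all a ∈ [1,k], which determines v_b for b ∈ [1,k] since p is a bijection).
Contains : (w : Perm) → (π : MeshPattern) → Set
Contains w π =
  ∃₂ λ (I V : ℕ → ℕ) →
    (I 0 ≡ 0) × (I (suc k) ≡ suc n) ×
    (∀ a → a ≤ k → I a < I (suc a)) ×
    (∀ a b → 1 ≤ a → a ≤ k → 1 ≤ b → b ≤ k →
       (ev w (I a) < ev w (I b) → ev p a < ev p b) ×
       (ev p a < ev p b → ev w (I a) < ev w (I b))) ×
    (V 0 ≡ 0) × (V (suc k) ≡ suc n) ×
    (∀ a → 1 ≤ a → a ≤ k → V (ev p a) ≡ ev w (I a)) ×
    -- shaded boxes are empty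
    (∀ a b → InR π a b → ∀ x → 1 ≤ x → x ≤ n →
       ¬ ((I a < x) × (x < I (suc a)) × (V b < ev w x) × (ev w x < V (suc b))))
  where
    p = pat π
    k = size p
    n = size w

Avoids : Perm → MeshPattern → Set
Avoids w π = ¬ Contains w π

Coincident : MeshPattern → MeshPattern → Set
Coincident π σ = ∀ (w : Perm) → (Avoids w π → Avoids w σ) × (Avoids w σ → Avoids w π)

module Submission where

-- Every pattern (p, R) occurs in p itself (take all indices), so if
-- Av(p, R) = Av(p', R') then p cannot avoid (p', R'): constructively, it is
-- not the case that p avoids (p', R'), and symmetrically for p'.  Because
-- equality of lists of naturals is decidable, it therefore suffices to show
-- that "p contains (p', R') and p' contains (p, R)" forces p = p'.
--   * An occurrence is given by strictly increasing indices 0 = i_0 < ... <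
--     i_{k+1} = n+1; a gap count shows k ≤ n, so mutual containment gives
--     equal sizes, and then the indices are forced to be i_a = a.
--   * An occurrence with i_a = a says that p and p' are order isomorphic.
--   * Two order-isomorphic permutations p, q of [1,k] are equal: the map
--     q ∘ p⁻¹ is a strictly increasing self-map of [1,k], hence the identity.

open import Defs
open import Data.Nat
open import Data.Nat.Properties
open import Data.List using (List; []; _∷_; length)
open import Data.List.Properties using (≡-dec)
open import Data.List.Membership.Propositional using (_∈_)
open import Data.List.Membership.Propositional.Properties using (∈-map⁺; ∈-map⁻; ∈-upTo⁺; ∈-upTo⁻)
open import Data.List.Relation.Binary.Permutation.Propositional using (↭-sym)
open import Data.List.Relation.Binary.Permutation.Propositional.Properties using (∈-resp-↭)
open import Data.List.Relation.Unary.Any using (here; there)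
open import Data.Product using (_×_; _,_; proj₁; proj₂)
open import Data.Empty using (⊥-elim)
open import Relation.Nullary using (¬_; yes; no)
open import Relation.Nullary.Decidable using (decidable-stable)
open import Relation.Binary using (tri<; tri≈; tri>)
open import Relation.Binary.PropositionalEquality

StrictlyIncreasingOn : ℕ → ℕ → (ℕ → ℕ) → Set
StrictlyIncreasingOn lo hi f = ∀ a → lo ≤ a → a < hi → f a < f (suc a)

increasing-gap : ∀ {lo hi f} → StrictlyIncreasingOn lo hi f →
                 ∀ a j → lo ≤ a → a + j ≤ hi → f a + j ≤ f (a + j)
increasing-gap {f = f} inc a zero _ _
  rewrite +-identityʳ a | +-identityʳ (f a) = ≤-refl
increasing-gap {f = f} inc a (suc j) lo≤a a+j<hi
  rewrite +-suc a j | +-suc (f a) j =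
  ≤-trans (s≤s (increasing-gap inc a j lo≤a (<⇒≤ a+j<hi)))
          (inc (a + j) (≤-trans lo≤a (m≤m+n a j)) a+j<hi)

increasing-≥-id : ∀ {lo hi f} → StrictlyIncreasingOn lo hi f → lo ≤ f lo →
                  ∀ a → lo ≤ a → a ≤ hi → a ≤ f a
increasing-≥-id {lo} {hi} {f} inc lo≤flo a lo≤a a≤hi = begin
  a                ≡⟨ m+[n∸m]≡n lo≤a ⟨
  lo + (a ∸ lo)    ≤⟨ +-monoˡ-≤ (a ∸ lo) lo≤flo ⟩
  f lo + (a ∸ lo)  ≤⟨ increasing-gap inc lo (a ∸ lo) ≤-refl lo+d≤hi ⟩
  f (lo + (a ∸ lo)) ≡⟨ cong f (m+[n∸m]≡n lo≤a) ⟩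
  f a              ∎
  where
  open ≤-Reasoning
  lo+d≤hi : lo + (a ∸ lo) ≤ hi
  lo+d≤hi = subst (_≤ hi) (sym (m+[n∸m]≡n lo≤a)) a≤hi

increasing-≤-id : ∀ {lo hi f} → StrictlyIncreasingOn lo hi f → f hi ≤ hi →
                  ∀ a → lo ≤ a → a ≤ hi → f a ≤ a
increasing-≤-id {hi = hi} {f} inc fhi≤hi a lo≤a a≤hi =
  +-cancelʳ-≤ (hi ∸ a) (f a) a (begin
    f a + (hi ∸ a)    ≤⟨ increasing-gap inc a (hi ∸ a) lo≤a (≤-reflexive a+d≡hi) ⟩
    f (a + (hi ∸ a))  ≡⟨ cong f a+d≡hi ⟩
    f hi              ≤⟨ fhi≤hi ⟩
    hi                ≡⟨ a+d≡hi ⟨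
    a + (hi ∸ a)      ∎)
  where
  open ≤-Reasoning
  a+d≡hi : a + (hi ∸ a) ≡ hi
  a+d≡hi = m+[n∸m]≡n a≤hi

increasing-id : ∀ {lo hi f} → StrictlyIncreasingOn lo hi f →
                lo ≤ f lo → f hi ≤ hi → ∀ a → lo ≤ a → a ≤ hi → f a ≡ a
increasing-id inc lo≤flo fhi≤hi a lo≤a a≤hi =
  ≤-antisym (increasing-≤-id inc fhi≤hi a lo≤a a≤hi)
            (increasing-≥-id inc lo≤flo a lo≤a a≤hi)

at-∈ : ∀ l a → 1 ≤ a → a ≤ length l → at l a ∈ l
at-∈ (x ∷ xs) (suc zero)    _ _        = here refl
at-∈ (x ∷ xs) (suc (suc a)) _ (s≤s le) = there (at-∈ xs (suc a) (s≤s z≤n) le)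

-- Position of the first occurrence of x in a list (junk if absent).
indexOf : ℕ → List ℕ → ℕ
indexOf x []       = 0
indexOf x (y ∷ ys) with x ≟ y
... | yes _ = 1
... | no  _ = suc (indexOf x ys)

indexOf-spec : ∀ {x} l → x ∈ l →
               1 ≤ indexOf x l × indexOf x l ≤ length l × at l (indexOf x l) ≡ x
indexOf-spec {x} (y ∷ ys) x∈ with x ≟ y
... | yes x≡y = s≤s z≤n , s≤s z≤n , sym x≡y
indexOf-spec {x} (y ∷ ys) (here x≡y) | no x≢y = ⊥-elim (x≢y x≡y)
indexOf-spec {x} (y ∷ ys) (there x∈ys) | no _ with indexOf-spec ys x∈ys
... | _ , i≤len , at≡x with indexOf x ys
...   | suc i = s≤s z≤n , s≤s i≤len , at≡x

at-ext : ∀ l l' → length l ≡ length l' →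
         (∀ a → 1 ≤ a → a ≤ length l → at l a ≡ at l' a) → l ≡ l'
at-ext []       []       _   _  = refl
at-ext (x ∷ xs) (y ∷ ys) len agree =
  cong₂ _∷_ (agree 1 (s≤s z≤n) (s≤s z≤n))
            (at-ext xs ys (suc-injective len) agree-tail)
  where
  agree-tail : ∀ a → 1 ≤ a → a ≤ length xs → at xs a ≡ at ys a
  agree-tail (suc a) _ le = agree (suc (suc a)) (s≤s z≤n) (s≤s le)

ev-range : ∀ p a → 1 ≤ a → a ≤ size p → 1 ≤ ev p a × ev p a ≤ size p
ev-range p a a≥1 a≤k with ∈-map⁻ suc (∈-resp-↭ (isPerm p) (at-∈ (word p) a a≥1 a≤k))
... | y , y∈ , ev≡sy rewrite ev≡sy = s≤s z≤n , ∈-upTo⁻ y∈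

letter-∈ : ∀ p j → 1 ≤ j → j ≤ size p → j ∈ word p
letter-∈ p (suc j) _ j<k = ∈-resp-↭ (↭-sym (isPerm p)) (∈-map⁺ suc (∈-upTo⁺ j<k))

OrderIsomorphic : Perm → Perm → Set
OrderIsomorphic p q = ∀ a b → 1 ≤ a → a ≤ size p → 1 ≤ b → b ≤ size p →
  (ev p a < ev p b → ev q a < ev q b) × (ev q a < ev q b → ev p a < ev p b)

order-isomorphic⇒≡ : ∀ p q → size q ≡ size p → OrderIsomorphic p q → word p ≡ word q
order-isomorphic⇒≡ p q sizes iso =
  at-ext (word p) (word q) (sym sizes) agree
  where
  k = size p

  pos : ℕ → ℕ
  pos j = indexOf j (word p)

  pos-spec : ∀ j → 1 ≤ j → j ≤ k → 1 ≤ pos j × pos j ≤ k × ev p (pos j) ≡ j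
  pos-spec j j≥1 j≤k = indexOf-spec (word p) (letter-∈ p j j≥1 j≤k)

  g : ℕ → ℕ
  g j = ev q (pos j)

  g-range : ∀ j → 1 ≤ j → j ≤ k → 1 ≤ g j × g j ≤ k
  g-range j j≥1 j≤k with pos-spec j j≥1 j≤k
  ... | i≥1 , i≤k , _ = subst (λ m → 1 ≤ g j × g j ≤ m) sizes
                          (ev-range q (pos j) i≥1 (subst (pos j ≤_) (sym sizes) i≤k))

  g-increasing : StrictlyIncreasingOn 1 k g
  g-increasing j j≥1 j<k with pos-spec j j≥1 (<⇒≤ j<k) | pos-spec (suc j) (s≤s z≤n) j<k
  ... | i≥1 , i≤k , pi≡j | i'≥1 , i'≤k , pi'≡sj =
    proj₁ (iso _ _ i≥1 i≤k i'≥1 i'≤k) (subst₂ _<_ (sym pi≡j) (sym pi'≡sj) ≤-refl)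

  g-id : ∀ j → 1 ≤ j → j ≤ k → g j ≡ j
  g-id j j≥1 j≤k = increasing-id g-increasing
    (proj₁ (g-range 1 ≤-refl k≥1)) (proj₂ (g-range k k≥1 ≤-refl)) j j≥1 j≤k
    where k≥1 = ≤-trans j≥1 j≤k

  ties : ∀ a b → 1 ≤ a → a ≤ k → 1 ≤ b → b ≤ k → ev p a ≡ ev p b → ev q a ≡ ev q b
  ties a b a≥1 a≤k b≥1 b≤k pa≡pb with <-cmp (ev q a) (ev q b)
  ... | tri≈ _ qa≡qb _ = qa≡qb
  ... | tri< qa<qb _ _ = ⊥-elim (<-irrefl pa≡pb (proj₂ (iso a b a≥1 a≤k b≥1 b≤k) qa<qb))
  ... | tri> _ _ qb<qa = ⊥-elim (<-irrefl (sym pa≡pb) (proj₂ (iso b a b≥1 b≤k a≥1 a≤k) qb<qa))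

  agree : ∀ a → 1 ≤ a → a ≤ k → ev p a ≡ ev q a
  agree a a≥1 a≤k with ev-range p a a≥1 a≤k
  ... | pa≥1 , pa≤k with pos-spec (ev p a) pa≥1 pa≤k
  ...   | i≥1 , i≤k , p-pos≡pa = begin
    ev p a          ≡⟨ g-id (ev p a) pa≥1 pa≤k ⟨
    g (ev p a)      ≡⟨ ties (pos (ev p a)) a i≥1 i≤k a≥1 a≤k p-pos≡pa ⟩
    ev q a          ∎
    where open ≡-Reasoning

contains-own-perm : ∀ π → Contains (pat π) π
contains-own-perm π =
  (λ a → a) , (λ b → b) , refl , refl , (λ a _ → ≤-refl) ,
  (λ _ _ _ _ _ _ → (λ lt → lt) , (λ lt → lt)) , refl , refl , (λ _ _ _ → refl) ,
  λ _ _ _ _ _ _ (a<x , x<sa , _) → <⇒≱ x<sa a<x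

occurrence-increasing : ∀ w σ (c : Contains w σ) →
  StrictlyIncreasingOn 0 (suc (size (pat σ))) (proj₁ c)
occurrence-increasing _ _ (_ , _ , _ , _ , inc , _) a _ a<sk = inc a (s≤s⁻¹ a<sk)

occurrence-size : ∀ w σ → Contains w σ → size (pat σ) ≤ size w
occurrence-size w σ c@(I , _ , I0≡0 , Isk≡sn , _) = s≤s⁻¹ (begin
  suc k          ≡⟨ cong (_+ suc k) I0≡0 ⟨
  I 0 + suc k    ≤⟨ increasing-gap (occurrence-increasing w σ c) 0 (suc k) z≤n ≤-refl ⟩
  I (suc k)      ≡⟨ Isk≡sn ⟩
  suc (size w)   ∎)
  where
  open ≤-Reasoning
  k = size (pat σ)

full-occurrence-indices : ∀ w σ (c : Contains w σ) → size (pat σ) ≡ size w →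
  ∀ a → a ≤ size (pat σ) → proj₁ c a ≡ a
full-occurrence-indices w σ c@(_ , _ , _ , Isk≡sn , _) sizes a a≤k =
  increasing-id (occurrence-increasing w σ c) z≤n
    (≤-reflexive (trans Isk≡sn (cong suc (sym sizes)))) a z≤n (m≤n⇒m≤1+n a≤k)

full-occurrence-order-isomorphic : ∀ w σ → Contains w σ →
  size (pat σ) ≡ size w → OrderIsomorphic (pat σ) w
full-occurrence-order-isomorphic w σ c@(I , _ , _ , _ , _ , order , _) sizes
  a b a≥1 a≤k b≥1 b≤k =
  (λ p<p → at-positions (proj₂ (order a b a≥1 a≤k b≥1 b≤k) p<p)) ,
  (λ w<w → proj₁ (order a b a≥1 a≤k b≥1 b≤k) (at-indices w<w))
  where
  at-positions : ev w (I a) < ev w (I b) → ev w a < ev w b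
  at-positions = subst₂ (λ i j → ev w i < ev w j)
    (full-occurrence-indices w σ c sizes a a≤k) (full-occurrence-indices w σ c sizes b b≤k)
  at-indices : ev w a < ev w b → ev w (I a) < ev w (I b)
  at-indices = subst₂ (λ i j → ev w i < ev w j)
    (sym (full-occurrence-indices w σ c sizes a a≤k)) (sym (full-occurrence-indices w σ c sizes b b≤k))

mutual-containment⇒≡ : ∀ π σ → Contains (pat π) σ → Contains (pat σ) π →
                       word (pat π) ≡ word (pat σ)
mutual-containment⇒≡ π σ π∋σ σ∋π =
  sym (order-isomorphic⇒≡ (pat σ) (pat π) (sym sizes)
        (full-occurrence-order-isomorphic (pat π) σ π∋σ sizes))
  where
  sizes : size (pat σ) ≡ size (pat π)
  sizes = ≤-antisym (occurrence-size (pat π) σ π∋σ) (occurrence-size (pat σ) π σ∋π)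

coincident-¬¬-contains : ∀ π σ → Coincident π σ →
                         ∀ w → Contains w π → ¬ ¬ Contains w σ
coincident-¬¬-contains _ _ co w w∋π w-avoids-σ = proj₂ (co w) w-avoids-σ w∋π

lemma4p1 : (π σ : MeshPattern) → Coincident π σ → word (pat π) ≡ word (pat σ)
lemma4p1 π σ co =
  decidable-stable (≡-dec _≟_ (word (pat π)) (word (pat σ))) λ p≢p' →
    coincident-¬¬-contains π σ co (pat π) (contains-own-perm π) λ π∋σ →
      coincident-¬¬-contains σ π co-sym (pat σ) (contains-own-perm σ) λ σ∋π →
        p≢p' (mutual-containment⇒≡ π σ π∋σ σ∋π)
  where
  co-sym : Coincident σ π
  co-sym w = proj₂ (co w) , proj₁ (co w)
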